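{- Let $G=(V,E,w)$ be an undirected graph with positive integer edge weights, $U\subseteq V$, $r\in U$, $\tau$ a positive integer, and let $C=\mathcal{C}_{G,U,\tau}(r)$ be the $\tau$-connected component of $G$ w.r.t. $U$ containing $r$. Suppose $|C|\ge\frac{15}{16}|U|$ and every $(\tau+1)$-connected component of $G$ w.r.t. $U$ has size smaller than $\frac34|U|$. Let $B=\{v\in C\setminus\mathcal{C}_{G,U,\tau+1}(r): |M_{G,v,r}\cap U|\le\frac{15}{16}|U|\}$. Then $|B|\ge\frac18|U|$.
   Context: $\lambda_G(u,v)$ is the minimum weight of a cut separating $u$ and $v$. The $\tau$-connected components of $G$ are the classes of the partition of $V$ in which $u\ne v$ are in the same class iff $\lambda_G(u,v)\ge\tau$; the $\tau$-connected components w.r.t. $U$ are their intersections with $U$, and $\mathcal{C}_{G,U,\tau}(x)$ denotes the one containing $x\in U$. For $v\neq r$, $M_{G,v,r}$ is the unique vertex-minimal $(v,r)$-mincut containing $v$: a set $S\subseteq V$ with $v\in S$, $r\notin S$, minimizing the weight of edges leaving $S$, and among such sets of minimum cardinality. -}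

module Defs where

open import Data.Nat using (ℕ; zero; suc; _+_; _*_; _≤_; _<_)
open import Data.Fin using (Fin)
open import Data.Fin.Subset using (Subset; _∈_; _∉_; _∩_; ∣_∣)
open import Data.Bool using (Bool; true; false; if_then_else_; _∧_; not)
open import Data.List using (List; map; allFin)
open import Data.Nat.ListAction using (sum)
open import Data.Vec using (lookup)
open import Data.Product using (_×_)
open import Data.Sum using (_⊎_)
open import Relation.Binary.PropositionalEquality using (_≡_; _≢_)
open import Function.Bundles using (_⇔_)

-- An undirected weighted graph on vertex set Fin n: w i j is the total
-- weight of edges between i and j (0 = no edge; positive integers otherwise).
record Graph (n : ℕ) : Set where
  field
    w    : Fin n → Fin n → ℕ
    symm : ∀ i j → w i j ≡ w j i

open Graph public

cutWeight : ∀ {n} → Graph n → Subset n → ℕ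
cutWeight {n} G S =
  sum (map (λ i → sum (map (λ j →
    if lookup S i ∧ not (lookup S j) then w G i j else 0) (allFin n))) (allFin n))

Separates : ∀ {n} → Subset n → Fin n → Fin n → Set
Separates S u v = (u ∈ S) × (v ∉ S)

λ≥ : ∀ {n} → Graph n → Fin n → Fin n → ℕ → Set
λ≥ G u v τ = ∀ S → Separates S u v → τ ≤ cutWeight G S

SameComp : ∀ {n} → Graph n → ℕ → Fin n → Fin n → Set
SameComp G τ u v = (u ≡ v) ⊎ λ≥ G u v τ

IsCompWrt : ∀ {n} → Graph n → Subset n → ℕ → Fin n → Subset n → Set
IsCompWrt {n} G U τ x D = ∀ (y : Fin n) → (y ∈ D) ⇔ ((y ∈ U) × SameComp G τ x y)

IsMinCut : ∀ {n} → Graph n → Fin n → Fin n → Subset n → Set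
IsMinCut G v r S = Separates S v r × (∀ T → Separates T v r → cutWeight G S ≤ cutWeight G T)

IsMinimalMinCut : ∀ {n} → Graph n → Fin n → Fin n → Subset n → Set
IsMinimalMinCut G v r S = IsMinCut G v r S × (∀ T → IsMinCut G v r T → ∣ S ∣ ≤ ∣ T ∣)

{-# OPTIONS --safe #-}
-- Cut weight is submodular, so a vertex-minimal (a,b)-mincut lies inside every (a,b)-cut of
-- weight at most λ(a,b). For v ∈ C ∖ C' we have λ(v,r) = τ, so M_v lies inside every (v,r)-cut
-- of weight ≤ τ and misses C'. Call v ∈ C ∖ C' bad if |M_v ∩ U| > 15/16 |U|. Without bad
-- vertices C ⊆ C' ∪ B, so |B| ≥ |C| - |C'| > (15/16 - 3/4)|U|. Otherwise take a bad v with
-- |M_v| minimal. Every bad u ∈ M_v has M_u ⊆ M_v, hence M_u = M_v by the choice of v, so u and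
-- v lie in each other's minimal cuts; uncrossing then shows that no cut of weight ≤ τ separates
-- them, i.e. u lies in the (τ+1)-component D of v. Thus M_v ∩ U ∩ C ⊆ B ∪ D, and since
-- |M_v ∩ U ∩ C| ≥ 7/8 |U| and |D| < 3/4 |U|, |B| ≥ 1/8 |U|.
module Submission where

open import Defs
open import Data.Nat using (ℕ; zero; suc; _+_; _*_; _≤_; _<_; z≤n; _≤?_; _<?_)
open import Data.Nat.Properties hiding (_≟_)
open import Data.Nat.Induction using (<-wellFounded)
open import Data.Nat.ListAction using () renaming (sum to listSum)
open import Data.Nat.Tactic.RingSolver using (solve)
open import Data.Bool using (Bool; true; false; if_then_else_; _∧_; _∨_; not)
open import Data.Bool.Properties using (T-≡)
open import Data.Fin using (Fin; zero; suc; _≟_)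
open import Data.Fin.Properties using (any?)
open import Data.Fin.Subset using (Subset; _∈_; _∉_; _∩_; _∪_; ∁; ∣_∣; _⊆_; inside; outside)
open import Data.Fin.Subset.Properties
open import Data.List as List using ([]; _∷_; allFin)
open import Data.List.Properties using (map-tabulate)
open import Data.Vec as Vec using (lookup)
open import Data.Vec.Properties using (lookup-zipWith; lookup-map; lookup∘tabulate; lookup⇒[]=; []=⇒lookup)
open import Data.Product using (_×_; _,_; proj₁; proj₂; ∃-syntax)
open import Data.Sum using (_⊎_; inj₁; inj₂; [_,_]′)
open import Function using (_∘_; id; case_of_)
open import Function.Bundles using (_⇔_; mk⇔; Equivalence)
open import Induction.WellFounded using (Acc; acc)
open import Level using (Level)
open import Relation.Nullary using (Dec; yes; no; ¬_; contradiction)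
open import Relation.Nullary.Decidable using (⌊_⌋; _×-dec_; _⊎-dec_; ¬?; map′; decidable-stable; toWitness; fromWitness)
open import Relation.Unary using (Pred; Decidable)
open import Relation.Binary.PropositionalEquality

open import Algebra.Properties.CommutativeMonoid.Sum +-0-commutativeMonoid
  using (sum; sum-syntax; ∑-distrib-+; ∑-comm; sum-cong-≗)

private
  variable
    ℓ : Level
    n : ℕ

listSum-tabulate : (f : Fin n → ℕ) → listSum (List.tabulate f) ≡ sum f
listSum-tabulate {zero}  f = refl
listSum-tabulate {suc n} f = cong (f zero +_) (listSum-tabulate (f ∘ suc))

listSum-allFin : (f : Fin n → ℕ) → listSum (List.map f (allFin n)) ≡ sum f
listSum-allFin f = trans (cong listSum (map-tabulate id f)) (listSum-tabulate f)

∑-mono-≤ : {f g : Fin n → ℕ} → (∀ i → f i ≤ g i) → sum f ≤ sum g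
∑-mono-≤ {zero}  f≤g = z≤n
∑-mono-≤ {suc n} f≤g = +-mono-≤ (f≤g zero) (∑-mono-≤ (f≤g ∘ suc))

∑-+-mono-≤ : {f g h k : Fin n → ℕ} → (∀ i → f i + g i ≤ h i + k i) → sum f + sum g ≤ sum h + sum k
∑-+-mono-≤ {f = f} {g} {h} {k} le = begin
  sum f + sum g              ≡⟨ ∑-distrib-+ f g ⟨
  sum (λ i → f i + g i)      ≤⟨ ∑-mono-≤ le ⟩
  sum (λ i → h i + k i)      ≡⟨ ∑-distrib-+ h k ⟩
  sum h + sum k              ∎
  where open ≤-Reasoning

-- Vec's constructors are opened only here: overloading them with List's makes the `solve`
-- calls below extremely slow.
module _ where
  open import Data.Vec using ([]; _∷_)

  ∣p∩q∣+∣p∪q∣≡∣p∣+∣q∣ : (p q : Subset n) → ∣ p ∩ q ∣ + ∣ p ∪ q ∣ ≡ ∣ p ∣ + ∣ q ∣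
  ∣p∩q∣+∣p∪q∣≡∣p∣+∣q∣ []            []            = refl
  ∣p∩q∣+∣p∪q∣≡∣p∣+∣q∣ (outside ∷ p) (outside ∷ q) = ∣p∩q∣+∣p∪q∣≡∣p∣+∣q∣ p q
  ∣p∩q∣+∣p∪q∣≡∣p∣+∣q∣ (inside  ∷ p) (outside ∷ q) =
    trans (+-suc ∣ p ∩ q ∣ _) (cong suc (∣p∩q∣+∣p∪q∣≡∣p∣+∣q∣ p q))
  ∣p∩q∣+∣p∪q∣≡∣p∣+∣q∣ (outside ∷ p) (inside  ∷ q) =
    trans (+-suc ∣ p ∩ q ∣ _) (trans (cong suc (∣p∩q∣+∣p∪q∣≡∣p∣+∣q∣ p q)) (sym (+-suc ∣ p ∣ _)))
  ∣p∩q∣+∣p∪q∣≡∣p∣+∣q∣ (inside  ∷ p) (inside  ∷ q) =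
    cong suc (trans (+-suc ∣ p ∩ q ∣ _) (trans (cong suc (∣p∩q∣+∣p∪q∣≡∣p∣+∣q∣ p q)) (sym (+-suc ∣ p ∣ _))))

∣p∪q∣≤∣p∣+∣q∣ : (p q : Subset n) → ∣ p ∪ q ∣ ≤ ∣ p ∣ + ∣ q ∣
∣p∪q∣≤∣p∣+∣q∣ p q = subst (∣ p ∪ q ∣ ≤_) (∣p∩q∣+∣p∪q∣≡∣p∣+∣q∣ p q) (m≤n+m _ _)

∣p∣+∣q∣≤∣p∩q∣+∣r∣ : {p q r : Subset n} → p ⊆ r → q ⊆ r → ∣ p ∣ + ∣ q ∣ ≤ ∣ p ∩ q ∣ + ∣ r ∣
∣p∣+∣q∣≤∣p∩q∣+∣r∣ {p = p} {q} {r} p⊆r q⊆r =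
  subst (_≤ ∣ p ∩ q ∣ + ∣ r ∣) (∣p∩q∣+∣p∪q∣≡∣p∣+∣q∣ p q)
    (+-monoʳ-≤ ∣ p ∩ q ∣ (p⊆q⇒∣p∣≤∣q∣ (λ x∈p∪q → [ p⊆r , q⊆r ]′ (x∈p∪q⁻ p q x∈p∪q))))

p⊆q∧∣q∣≤∣p∣⇒p≡q : {p q : Subset n} → p ⊆ q → ∣ q ∣ ≤ ∣ p ∣ → p ≡ q
p⊆q∧∣q∣≤∣p∣⇒p≡q {p = p} {q} p⊆q ∣q∣≤∣p∣ = ⊆-antisym p⊆q q⊆p
  where
  q⊆p : q ⊆ p
  q⊆p {x} x∈q with x ∈? p
  ... | yes x∈p = x∈p
  ... | no  x∉p = contradiction ∣q∣≤∣p∣ (<⇒≱ (p⊂q⇒∣p∣<∣q∣ (p⊆q , x , x∈q , x∉p)))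

select : {P : Pred (Fin n) ℓ} → Decidable P → Subset n
select P? = Vec.tabulate (λ x → ⌊ P? x ⌋)

∈-select : {P : Pred (Fin n) ℓ} (P? : Decidable P) (x : Fin n) → x ∈ select P? ⇔ P x
∈-select P? x = mk⇔
  (λ x∈ → toWitness (Equivalence.from T-≡ (trans (sym (lookup∘tabulate _ x)) ([]=⇒lookup x∈))))
  (λ Px → lookup⇒[]= x _ (trans (lookup∘tabulate _ x) (Equivalence.to T-≡ (fromWitness Px))))

∃-minimal : {P : Pred (Fin n) ℓ} → Decidable P → (f : Fin n → ℕ) →
            ∀ {a} → P a → ∃[ b ] P b × (∀ c → P c → f b ≤ f c)
∃-minimal {P = P} P? f Pa = go (<-wellFounded _) Pa
  where
  go : ∀ {a} → Acc _<_ (f a) → P a → ∃[ b ] P b × (∀ c → P c → f b ≤ f c)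
  go {a} (acc smaller) Pa with any? (λ c → P? c ×-dec f c <? f a)
  ... | yes (c , Pc , fc<fa) = go (smaller fc<fa) Pc
  ... | no  ∄smaller         = a , Pa , λ c Pc → ≮⇒≥ (λ fc<fa → ∄smaller (c , Pc , fc<fa))

crossing : Bool → Bool → ℕ → ℕ
crossing s t x = if s ∧ not t then x else 0

crossing-submodular : ∀ a b c d x →
  crossing (a ∧ b) (c ∧ d) x + crossing (a ∨ b) (c ∨ d) x ≤ crossing a c x + crossing b d x
crossing-submodular true  true  true  true  x = ≤-refl
crossing-submodular true  true  true  false x = ≤-reflexive (+-comm x 0)
crossing-submodular true  true  false true  x = ≤-refl
crossing-submodular true  true  false false x = ≤-refl
crossing-submodular true  false true  d     x = z≤n
crossing-submodular true  false false true  x = z≤n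
crossing-submodular true  false false false x = ≤-reflexive (+-comm 0 x)
crossing-submodular false true  true  true  x = z≤n
crossing-submodular false true  false true  x = z≤n
crossing-submodular false true  true  false x = z≤n
crossing-submodular false true  false false x = ≤-refl
crossing-submodular false false c     d     x = z≤n

module _ (G : Graph n) where

  edgeCrossing : Subset n → Fin n → Fin n → ℕ
  edgeCrossing S i j = crossing (lookup S i) (lookup S j) (w G i j)

  cutWeight≡∑∑ : ∀ S → cutWeight G S ≡ ∑[ i < n ] ∑[ j < n ] edgeCrossing S i j
  cutWeight≡∑∑ S =
    trans (listSum-allFin (λ i → listSum (List.map (edgeCrossing S i) (allFin n))))
          (sum-cong-≗ (λ i → listSum-allFin (edgeCrossing S i)))

  cutWeight-submodular : ∀ P Q → cutWeight G (P ∩ Q) + cutWeight G (P ∪ Q) ≤ cutWeight G P + cutWeight G Q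
  cutWeight-submodular P Q =
    subst₂ _≤_ (sym (cong₂ _+_ (cutWeight≡∑∑ (P ∩ Q)) (cutWeight≡∑∑ (P ∪ Q))))
               (sym (cong₂ _+_ (cutWeight≡∑∑ P) (cutWeight≡∑∑ Q)))
      (∑-+-mono-≤ λ i → ∑-+-mono-≤ λ j → edgeCrossing-submodular i j)
    where
    edgeCrossing-submodular : ∀ i j →
      edgeCrossing (P ∩ Q) i j + edgeCrossing (P ∪ Q) i j ≤ edgeCrossing P i j + edgeCrossing Q i j
    edgeCrossing-submodular i j
      rewrite lookup-zipWith _∧_ i P Q | lookup-zipWith _∧_ j P Q
            | lookup-zipWith _∨_ i P Q | lookup-zipWith _∨_ j P Q
      = crossing-submodular (lookup P i) (lookup Q i) (lookup P j) (lookup Q j) (w G i j)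

  cutWeight-∁ : ∀ S → cutWeight G (∁ S) ≡ cutWeight G S
  cutWeight-∁ S = begin
    cutWeight G (∁ S)                         ≡⟨ cutWeight≡∑∑ (∁ S) ⟩
    ∑[ i < n ] ∑[ j < n ] edgeCrossing (∁ S) i j ≡⟨ sum-cong-≗ (λ i → sum-cong-≗ (edgeCrossing-∁ i)) ⟩
    ∑[ i < n ] ∑[ j < n ] edgeCrossing S j i  ≡⟨ ∑-comm (λ i j → edgeCrossing S j i) ⟩
    ∑[ j < n ] ∑[ i < n ] edgeCrossing S j i  ≡⟨ cutWeight≡∑∑ S ⟨
    cutWeight G S                             ∎
    where
    open ≡-Reasoning
    edgeCrossing-∁ : ∀ i j → edgeCrossing (∁ S) i j ≡ edgeCrossing S j i
    edgeCrossing-∁ i j rewrite lookup-map i not S | lookup-map j not S with lookup S i | lookup S j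
    ... | true  | true  = refl
    ... | true  | false = refl
    ... | false | true  = symm G i j
    ... | false | false = refl

module _ (G : Graph n) where

  CutBelow : Fin n → Fin n → ℕ → Set
  CutBelow a b t = ∃[ S ] Separates S a b × cutWeight G S < t

  cutBelow? : ∀ a b t → Dec (CutBelow a b t)
  cutBelow? a b t = anySubset? (λ S → ((a ∈? S) ×-dec ¬? (b ∈? S)) ×-dec (cutWeight G S <? t))

  ¬cutBelow⇒λ≥ : ∀ {a b t} → ¬ CutBelow a b t → λ≥ G a b t
  ¬cutBelow⇒λ≥ ∄S S sep = ≮⇒≥ (λ below → ∄S (S , sep , below))

  ¬λ≥⇒cutBelow : ∀ {a b t} → ¬ λ≥ G a b t → CutBelow a b t
  ¬λ≥⇒cutBelow {a} {b} {t} ¬λ≥ = decidable-stable (cutBelow? a b t) (¬λ≥ ∘ ¬cutBelow⇒λ≥)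

  λ≥? : ∀ a b t → Dec (λ≥ G a b t)
  λ≥? a b t = map′ ¬cutBelow⇒λ≥ (λ λ≥ab (S , sep , below) → <⇒≱ below (λ≥ab S sep)) (¬? (cutBelow? a b t))

  λ≥-sym : ∀ {a b t} → λ≥ G a b t → λ≥ G b a t
  λ≥-sym λ≥ab S (b∈S , a∉S) =
    subst (_ ≤_) (cutWeight-∁ G S) (λ≥ab (∁ S) (x∉p⇒x∈∁p a∉S , x∈p⇒x∉∁p b∈S))

  component : ∀ U t x → ∃[ D ] IsCompWrt G U t x D
  component U t x = select sameComp? , ∈-select sameComp?
    where
    sameComp? : Decidable (λ y → y ∈ U × SameComp G t x y)
    sameComp? y = (y ∈? U) ×-dec ((x ≟ y) ⊎-dec λ≥? x y t)

  minimalMinCut⊆minCut : ∀ {a b M Q} → IsMinimalMinCut G a b M → IsMinCut G a b Q → M ⊆ Q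
  minimalMinCut⊆minCut {a} {b} {M} {Q} (((a∈M , b∉M) , M-min) , M-minimal) ((a∈Q , b∉Q) , Q-min) =
    subst (_⊆ Q) (p⊆q∧∣q∣≤∣p∣⇒p≡q (p∩q⊆p M Q) (M-minimal (M ∩ Q) M∩Q-minCut)) (p∩q⊆q M Q)
    where
    M∪Q-sep : Separates (M ∪ Q) a b
    M∪Q-sep = p⊆p∪q Q a∈M , λ b∈M∪Q → [ b∉M , b∉Q ]′ (x∈p∪q⁻ M Q b∈M∪Q)
    M∩Q-sep : Separates (M ∩ Q) a b
    M∩Q-sep = x∈p∩q⁺ (a∈M , a∈Q) , λ b∈M∩Q → b∉M (proj₁ (x∈p∩q⁻ M Q b∈M∩Q))
    M∩Q-light : cutWeight G (M ∩ Q) ≤ cutWeight G Q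
    M∩Q-light = +-cancelʳ-≤ (cutWeight G (M ∪ Q)) _ _ (begin
      cutWeight G (M ∩ Q) + cutWeight G (M ∪ Q) ≤⟨ cutWeight-submodular G M Q ⟩
      cutWeight G M + cutWeight G Q             ≤⟨ +-monoˡ-≤ _ (M-min (M ∪ Q) M∪Q-sep) ⟩
      cutWeight G (M ∪ Q) + cutWeight G Q       ≡⟨ +-comm _ (cutWeight G Q) ⟩
      cutWeight G Q + cutWeight G (M ∪ Q)       ∎)
      where open ≤-Reasoning
    M∩Q-minCut : IsMinCut G a b (M ∩ Q)
    M∩Q-minCut = M∩Q-sep , λ T T-sep → ≤-trans M∩Q-light (Q-min T T-sep)

  minimalMinCut⊆lightCut : ∀ {a b t M Q} → λ≥ G a b t → IsMinimalMinCut G a b M →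
                           Separates Q a b → cutWeight G Q ≤ t → M ⊆ Q
  minimalMinCut⊆lightCut λ≥ab M-minimal Q-sep Q-light =
    minimalMinCut⊆minCut M-minimal (Q-sep , λ T T-sep → ≤-trans Q-light (λ≥ab T T-sep))

  mutualMinimalMinCuts⇒λ≥ : ∀ {u v r t Mᵤ Mᵥ} → λ≥ G u r t → λ≥ G v r t →
    IsMinimalMinCut G u r Mᵤ → IsMinimalMinCut G v r Mᵥ → v ∈ Mᵤ → u ∈ Mᵥ → λ≥ G u v (suc t)
  mutualMinimalMinCuts⇒λ≥ {v = v} {r} {t} λ≥ur λ≥vr Mᵤ-minimal Mᵥ-minimal v∈Mᵤ u∈Mᵥ S (u∈S , v∉S) =
    ≰⇒> S-heavy
    where
    S-heavy : ¬ cutWeight G S ≤ t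
    S-heavy S-light with r ∈? S
    ... | no  r∉S = v∉S (minimalMinCut⊆lightCut λ≥ur Mᵤ-minimal (u∈S , r∉S) S-light v∈Mᵤ)
    ... | yes r∈S = x∈∁p⇒x∉p (minimalMinCut⊆lightCut λ≥vr Mᵥ-minimal ∁S-sep ∁S-light u∈Mᵥ) u∈S
      where
      ∁S-sep : Separates (∁ S) v r
      ∁S-sep = x∉p⇒x∈∁p v∉S , x∈p⇒x∉∁p r∈S
      ∁S-light : cutWeight G (∁ S) ≤ t
      ∁S-light = subst (_≤ t) (sym (cutWeight-∁ G S)) S-light

overlap-≥7/8 : ∀ u x c a → 15 * u ≤ 16 * x → 15 * u ≤ 16 * c → x + c ≤ a + u → 7 * u ≤ 8 * a
overlap-≥7/8 u x c a x-large c-large x+c≤a+u =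
  *-cancelˡ-≤ 2 (+-cancelʳ-≤ (16 * u) _ _ (begin
    2 * (7 * u) + 16 * u    ≡⟨ solve (u ∷ []) ⟩
    15 * u + 15 * u         ≤⟨ +-mono-≤ x-large c-large ⟩
    16 * x + 16 * c         ≡⟨ *-distribˡ-+ 16 x c ⟨
    16 * (x + c)            ≤⟨ *-monoʳ-≤ 16 x+c≤a+u ⟩
    16 * (a + u)            ≡⟨ solve (a ∷ u ∷ []) ⟩
    2 * (8 * a) + 16 * u    ∎))
  where open ≤-Reasoning

≥15/16⇒≥7/8 : ∀ u c → 15 * u ≤ 16 * c → 7 * u ≤ 8 * c
≥15/16⇒≥7/8 u c c-large = *-cancelˡ-≤ 2 (begin
  2 * (7 * u)    ≡⟨ solve (u ∷ []) ⟩
  14 * u         ≤⟨ *-monoˡ-≤ u (n≤1+n 14) ⟩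
  15 * u         ≤⟨ c-large ⟩
  16 * c         ≡⟨ solve (c ∷ []) ⟩
  2 * (8 * c)    ∎)
  where open ≤-Reasoning

remainder-≥1/8 : ∀ u a b d → 7 * u ≤ 8 * a → a ≤ b + d → 4 * d < 3 * u → u ≤ 8 * b
remainder-≥1/8 u a b d a-large a≤b+d d-small =
  <⇒≤ (+-cancelˡ-< (6 * u) _ _ (begin-strict
    6 * u + u               ≡⟨ solve (u ∷ []) ⟩
    7 * u                   ≤⟨ a-large ⟩
    8 * a                   ≤⟨ *-monoʳ-≤ 8 a≤b+d ⟩
    8 * (b + d)             ≡⟨ solve (b ∷ d ∷ []) ⟩
    8 * b + 2 * (4 * d)     <⟨ +-monoʳ-< (8 * b) (*-monoʳ-< 2 d-small) ⟩
    8 * b + 2 * (3 * u)     ≡⟨ solve (b ∷ u ∷ []) ⟩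
    6 * u + 8 * b           ∎))
  where open ≤-Reasoning

module Claim
  (G : Graph n) (U : Subset n) (r : Fin n) (r∈U : r ∈ U) (τ : ℕ)
  (C : Subset n) (C-comp : IsCompWrt G U τ r C) (C-large : 15 * ∣ U ∣ ≤ 16 * ∣ C ∣)
  (comps-small : ∀ x D → x ∈ U → IsCompWrt G U (suc τ) x D → 4 * ∣ D ∣ < 3 * ∣ U ∣)
  (C' : Subset n) (C'-comp : IsCompWrt G U (suc τ) r C')
  (M : Fin n → Subset n) (M-minimal : ∀ v → v ≢ r → IsMinimalMinCut G v r (M v))
  (B : Subset n)
  (B-def : ∀ v → (v ∈ B) ⇔ ((v ∈ C) × (v ∉ C') × (16 * ∣ M v ∩ U ∣ ≤ 15 * ∣ U ∣)))
  where

  open Equivalence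

  C⊆U : C ⊆ U
  C⊆U {v} v∈C = proj₁ (to (C-comp v) v∈C)

  ∉C'⇒≢r : ∀ {v} → v ∉ C' → v ≢ r
  ∉C'⇒≢r v∉C' refl = v∉C' (from (C'-comp r) (r∈U , inj₁ refl))

  λ≥-C : ∀ {v} → v ∈ C → v ≢ r → λ≥ G v r τ
  λ≥-C {v} v∈C v≢r with proj₂ (to (C-comp v) v∈C)
  ... | inj₁ r≡v  = contradiction (sym r≡v) v≢r
  ... | inj₂ λ≥rv = λ≥-sym G λ≥rv

  lightCut⇒∉C' : ∀ {v S} → Separates S v r → cutWeight G S ≤ τ → v ∉ C'
  lightCut⇒∉C' {v} {S} (v∈S , r∉S) S-light v∈C' with proj₂ (to (C'-comp v) v∈C')
  ... | inj₁ r≡v  = r∉S (subst (_∈ S) (sym r≡v) v∈S)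
  ... | inj₂ λ≥rv = 1+n≰n (≤-trans (λ≥-sym G λ≥rv S (v∈S , r∉S)) S-light)

  ∉C'⇒¬λ≥ : ∀ {v} → v ∈ U → v ∉ C' → ¬ λ≥ G v r (suc τ)
  ∉C'⇒¬λ≥ {v} v∈U v∉C' λ≥vr = v∉C' (from (C'-comp v) (v∈U , inj₂ (λ≥-sym G λ≥vr)))

  M-sep : ∀ {v} → v ∉ C' → Separates (M v) v r
  M-sep v∉C' = proj₁ (proj₁ (M-minimal _ (∉C'⇒≢r v∉C')))

  M-light : ∀ {v} → v ∈ U → v ∉ C' → cutWeight G (M v) ≤ τ
  M-light {v} v∈U v∉C' with ¬λ≥⇒cutBelow G (∉C'⇒¬λ≥ v∈U v∉C')
  ... | S , S-sep , S-below =
    ≤-trans (proj₂ (proj₁ (M-minimal v (∉C'⇒≢r v∉C'))) S S-sep) (m<1+n⇒m≤n S-below)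

  M-disjoint-C' : ∀ {u v} → v ∈ U → v ∉ C' → u ∈ M v → u ∉ C'
  M-disjoint-C' v∈U v∉C' u∈Mv = lightCut⇒∉C' (u∈Mv , proj₂ (M-sep v∉C')) (M-light v∈U v∉C')

  Bad : Fin n → Set
  Bad v = v ∈ C × v ∉ C' × 15 * ∣ U ∣ < 16 * ∣ M v ∩ U ∣

  bad? : Decidable Bad
  bad? v = (v ∈? C) ×-dec ¬? (v ∈? C') ×-dec (15 * ∣ U ∣ <? 16 * ∣ M v ∩ U ∣)

  ∈B⊎Bad : ∀ {v} → v ∈ C → v ∉ C' → v ∈ B ⊎ Bad v
  ∈B⊎Bad {v} v∈C v∉C' with 16 * ∣ M v ∩ U ∣ ≤? 15 * ∣ U ∣
  ... | yes small = inj₁ (from (B-def v) (v∈C , v∉C' , small))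
  ... | no  large = inj₂ (v∈C , v∉C' , ≰⇒> large)

  bound-without-bad : (∀ v → ¬ Bad v) → ∣ U ∣ ≤ 8 * ∣ B ∣
  bound-without-bad no-bad =
    remainder-≥1/8 (∣ U ∣) (∣ C ∣) (∣ B ∣) (∣ C' ∣)
      (≥15/16⇒≥7/8 (∣ U ∣) (∣ C ∣) C-large)
      (≤-trans (p⊆q⇒∣p∣≤∣q∣ C⊆B∪C') (∣p∪q∣≤∣p∣+∣q∣ B C'))
      (comps-small r C' r∈U C'-comp)
    where
    C⊆B∪C' : C ⊆ B ∪ C'
    C⊆B∪C' {v} v∈C with v ∈? C'
    ... | yes v∈C' = q⊆p∪q B C' v∈C'
    ... | no  v∉C' = p⊆p∪q C' ([ id , (λ bad → contradiction bad (no-bad v)) ]′ (∈B⊎Bad v∈C v∉C'))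

  module MinimalBad {v} (v-bad : Bad v) (minimal : ∀ u → Bad u → ∣ M v ∣ ≤ ∣ M u ∣) where

    v∈C : v ∈ C
    v∈C = proj₁ v-bad

    v∉C' : v ∉ C'
    v∉C' = proj₁ (proj₂ v-bad)

    v≢r : v ≢ r
    v≢r = ∉C'⇒≢r v∉C'

    D : Subset n
    D = proj₁ (component G U (suc τ) v)

    D-comp : IsCompWrt G U (suc τ) v D
    D-comp = proj₂ (component G U (suc τ) v)

    v∈M : ∀ {u} → u ∈ M v → Bad u → v ∈ M u
    v∈M {u} u∈Mv u-bad@(u∈C , u∉C' , _) =
      subst (v ∈_) (sym (p⊆q∧∣q∣≤∣p∣⇒p≡q Mu⊆Mv (minimal u u-bad))) (proj₁ (M-sep v∉C'))
      where
      Mu⊆Mv : M u ⊆ M v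
      Mu⊆Mv = minimalMinCut⊆lightCut G (λ≥-C u∈C (∉C'⇒≢r u∉C')) (M-minimal u (∉C'⇒≢r u∉C'))
                (u∈Mv , proj₂ (M-sep v∉C')) (M-light (C⊆U v∈C) v∉C')

    bad∈M⇒sameComp : ∀ {u} → u ∈ M v → Bad u → SameComp G (suc τ) v u
    bad∈M⇒sameComp {u} u∈Mv u-bad@(u∈C , u∉C' , _) =
      inj₂ (mutualMinimalMinCuts⇒λ≥ G (λ≥-C v∈C v≢r) (λ≥-C u∈C u≢r)
              (M-minimal v v≢r) (M-minimal u u≢r) u∈Mv (v∈M u∈Mv u-bad))
      where
      u≢r : u ≢ r
      u≢r = ∉C'⇒≢r u∉C'

    A : Subset n
    A = (M v ∩ U) ∩ C

    A⊆B∪D : A ⊆ B ∪ D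
    A⊆B∪D {u} u∈A = [ p⊆p∪q D , bad⇒∈D ]′ (∈B⊎Bad u∈C (M-disjoint-C' (C⊆U v∈C) v∉C' u∈Mv))
      where
      u∈Mv : u ∈ M v
      u∈Mv = proj₁ (x∈p∩q⁻ (M v) U (proj₁ (x∈p∩q⁻ (M v ∩ U) C u∈A)))
      u∈C : u ∈ C
      u∈C = proj₂ (x∈p∩q⁻ (M v ∩ U) C u∈A)
      bad⇒∈D : Bad u → u ∈ B ∪ D
      bad⇒∈D u-bad = q⊆p∪q B D (from (D-comp u) (C⊆U u∈C , bad∈M⇒sameComp u∈Mv u-bad))

    bound : ∣ U ∣ ≤ 8 * ∣ B ∣
    bound = remainder-≥1/8 (∣ U ∣) (∣ A ∣) (∣ B ∣) (∣ D ∣)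
      (overlap-≥7/8 (∣ U ∣) (∣ M v ∩ U ∣) (∣ C ∣) (∣ A ∣)
        (<⇒≤ (proj₂ (proj₂ v-bad))) C-large (∣p∣+∣q∣≤∣p∩q∣+∣r∣ (p∩q⊆q (M v) U) C⊆U))
      (≤-trans (p⊆q⇒∣p∣≤∣q∣ A⊆B∪D) (∣p∪q∣≤∣p∣+∣q∣ B D))
      (comps-small v D (C⊆U v∈C) D-comp)

claim6p25 : ∀ {n : ℕ} (G : Graph n)
    → (∀ i j → w G i j ≢ 0 → 1 ≤ w G i j)
    → (U : Subset n) (r : Fin n) → r ∈ U
    → (τ : ℕ) → 1 ≤ τ
    → (C : Subset n) → IsCompWrt G U τ r C
    → 15 * ∣ U ∣ ≤ 16 * ∣ C ∣
    → (∀ x D → x ∈ U → IsCompWrt G U (suc τ) x D → 4 * ∣ D ∣ < 3 * ∣ U ∣)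
    → (C' : Subset n) → IsCompWrt G U (suc τ) r C'
    → (M : Fin n → Subset n) → (∀ v → v ≢ r → IsMinimalMinCut G v r (M v))
    → (B : Subset n)
    → (∀ v → (v ∈ B) ⇔ ((v ∈ C) × (v ∉ C') × (16 * ∣ M v ∩ U ∣ ≤ 15 * ∣ U ∣)))
    → ∣ U ∣ ≤ 8 * ∣ B ∣
claim6p25 G _ U r r∈U τ _ C C-comp C-large comps-small C' C'-comp M M-minimal B B-def =
  case any? bad? of λ where
    (yes (v , v-bad)) →
      let (v₀ , v₀-bad , v₀-minimal) = ∃-minimal bad? (∣_∣ ∘ M) v-bad
      in  MinimalBad.bound v₀-bad v₀-minimal
    (no ∄bad) → bound-without-bad (λ v v-bad → ∄bad (v , v-bad))
  where
  open Claim G U r r∈U τ C C-comp C-large comps-small C' C'-comp M M-minimal B B-def
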